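{- For integers $k\ge1$ and $1\le r\le n$, $$t(n,k,r)=(-1)^{n+r}\sum_{C\in\mathcal{C}(n,r)}\mathrm{wt}^{(k)}(C).$$
   Context: $s(a,b)$ denotes the signed Stirling numbers of the first kind, $x(x-1)\cdots(x-a+1)=\sum_b s(a,b)x^b$, and $t(n,k,r)=\sum\prod_{j=1}^{k}s(i_{j-1},i_j)$ over integer tuples $n\ge i_1\ge\dots\ge i_{k-1}\ge r$ with $i_0=n$, $i_k=r$. $\mathcal{C}(n,r)$ is the set of diagrams $C$ on the points $1,\dots,n$ consisting of exactly $n-r$ directed edges $i\to j$ with $1\le i<j\le n$, such that each point has at most one incoming edge (so $C$ has $r$ connected components). A $k$-labeling of $C$ is a map $c$ from the edges of $C$ to $\{1,\dots,k\}$ such that $c(i,j)\le c(j,m)$ whenever $i\to j$ and $j\to m$ are both edges of $C$. $\mathrm{wt}^{(k)}(C)$ is the number of $k$-labelings of $C$. -}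

module Defs where

open import Data.Nat as ℕ using (ℕ; zero; suc; _∸_; _≡ᵇ_; _≤ᵇ_)
open import Data.Integer as ℤ using (ℤ; +_; -_; _*_; _+_)
open import Data.Fin using (Fin; toℕ)
open import Data.List using (List; []; _∷_; map; foldr; concatMap; length; filterᵇ; upTo; allFin)
open import Data.Bool.ListAction using (and)
open import Data.Maybe using (Maybe; nothing; just)
open import Data.Bool using (Bool; true; false)
open import Data.Product using (_×_; _,_)
open import Data.Unit using (⊤; tt)

-- Polynomials with integer coefficients as coefficient lists
-- (index b = coefficient of x^b).

coeff : List ℤ → ℕ → ℤ
coeff []       _       = + 0
coeff (c ∷ cs) zero    = c
coeff (c ∷ cs) (suc b) = coeff cs b

mulXminus : ℕ → List ℤ → List ℤ
mulXminus a p = addP (+ 0 ∷ p) (map (λ c → - (+ a * c)) p)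
  where
  addP : List ℤ → List ℤ → List ℤ
  addP []       q        = q
  addP p        []       = p
  addP (x ∷ xs) (y ∷ ys) = (x + y) ∷ addP xs ys

falling : ℕ → List ℤ
falling zero    = + 1 ∷ []
falling (suc a) = mulXminus a (falling a)

s : ℕ → ℕ → ℤ
s a b = coeff (falling a) b

-- t(n,k,r) = Σ Π_{j=1}^k s(i_{j-1}, i_j) over n ≥ i_1 ≥ … ≥ i_{k-1} ≥ r,
-- i_0 = n, i_k = r.

sumℤ : List ℤ → ℤ
sumℤ = foldr _+_ (+ 0)

range : ℕ → ℕ → List ℕ
range r m = map (r ℕ.+_) (upTo (suc m ∸ r))

-- chain m j r : sum over m ≥ i_1 ≥ … ≥ i_j ≥ r of s(m,i_1) s(i_1,i_2) … s(i_j,r)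
chain : ℕ → ℕ → ℕ → ℤ
chain m zero    r = s m r
chain m (suc j) r = sumℤ (map (λ i → s m i * chain i j r) (range r m))

-- t n k r (only meaningful for k ≥ 1; for k = 0 we put the empty-product value)
t : ℕ → ℕ → ℕ → ℤ
t n zero    r = if n ≡ᵇ r then + 1 else + 0
  where open import Data.Bool using (if_then_else_)
t n (suc k) r = chain n k r

-- Diagrams on points 1..n (here indexed 0..n-1): each point has at most
-- one incoming edge i → j with i < j, so a diagram is the choice, for each
-- point j, of either no incoming edge or its source i < j.

data Diagram : ℕ → Set where
  []  : Diagram 0
  _▸_ : ∀ {n} → Diagram n → Maybe (Fin n) → Diagram (suc n)

allDiagrams : (n : ℕ) → List (Diagram n)
allDiagrams zero    = [] ∷ []
allDiagrams (suc n) =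
  concatMap (λ D → map (D ▸_) (nothing ∷ map just (allFin n))) (allDiagrams n)

edges : ∀ {n} → Diagram n → ℕ
edges []             = 0
edges (D ▸ nothing)  = edges D
edges (D ▸ just _)   = suc (edges D)

parentOf : ∀ {n} → Diagram n → ℕ → Maybe ℕ
parentOf []                    m = nothing
parentOf (_▸_ {n} D x) m with m ≡ᵇ n
... | true  = Data.Maybe.map toℕ x
  where import Data.Maybe
... | false = parentOf D m

𝒞 : (n : ℕ) → ℕ → List (Diagram n)
𝒞 n r = filterᵇ (λ D → edges D ≡ᵇ (n ∸ r)) (allDiagrams n)

-- k-labelings: a label in {1..k} (here Fin k) for each edge; edges are
-- identified with their (unique) target point.

Labeling : ℕ → ∀ {n} → Diagram n → Set
Labeling k []           = ⊤
Labeling k (D ▸ nothing) = Labeling k D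
Labeling k (D ▸ just _)  = Labeling k D × Fin k

allLabelings : (k : ℕ) → ∀ {n} (D : Diagram n) → List (Labeling k D)
allLabelings k []            = tt ∷ []
allLabelings k (D ▸ nothing) = allLabelings k D
allLabelings k (D ▸ just _)  =
  concatMap (λ c → map (c ,_) (allFin k)) (allLabelings k D)

labelOf : ∀ {k n} (D : Diagram n) → Labeling k D → ℕ → Maybe ℕ
labelOf []                       _       m = nothing
labelOf (_▸_ {n} D nothing)      c       m = labelOf D c m
labelOf (_▸_ {n} D (just _))     (c , l) m with m ≡ᵇ n
... | true  = just (toℕ l)
... | false = labelOf D c m

isLabeling : ∀ {k n} (D : Diagram n) → Labeling k D → Bool
isLabeling {k} {n} D c = and (map ok (upTo n))
  where
  ok : ℕ → Bool
  ok m with parentOf D m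
  ... | nothing = true
  ... | just j with labelOf D c j | labelOf D c m
  ...   | just a | just b = a ≤ᵇ b
  ...   | _      | _      = true

wt : (k : ℕ) → ∀ {n} → Diagram n → ℕ
wt k D = length (filterᵇ (isLabeling D) (allLabelings k D))

{-# OPTIONS --safe #-}
module Submission where

-- Reading a diagram from left to right, point by point, the k-labelled diagrams in 𝒞(n,r) are
-- counted by a recursion whose state is the list of levels of the points placed so far, the
-- level of a point being the label of its incoming edge (0 for a root). With labels 0, …, k a
-- point of the top level k can only receive edges labelled k, so such points matter only through
-- their number. Splitting them off writes the count for k + 1 labels on n points as
-- Σₘ c(n,m) · (the count for k labels on m points), c being the unsigned Stirling numbers of the
-- first kind. Since s(n,m) = (-1)^(n+m) c(n,m), this is the recursion t(n,k+1,r) = Σᵢ s(n,i) t(i,k,r)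
-- up to the sign (-1)^(n+r), and for one label both sides are s(n,r).

open import Defs
open import Algebra.Properties.CommutativeSemigroup as CommSemigroup using ()
open import Data.Bool using (Bool; true; false; T; _∧_)
open import Data.Bool.ListAction using (and)
open import Data.Bool.Properties using (T-≡; ∧-assoc; ∧-identityʳ)
open import Data.Empty using (⊥-elim)
open import Data.Fin as Fin using (toℕ)
open import Data.Fin.Properties using (toℕ<n)
open import Data.Integer as ℤ using (ℤ; +_; -_; _^_)
open import Data.Integer.Properties as ℤ using ()
import Data.Integer.Tactic.RingSolver as ℤ-Solver
open import Data.List using (List; []; _∷_; _++_; map; concatMap; length; filterᵇ; upTo; applyUpTo; allFin; tabulate)
open import Data.List.Properties using (map-cong; map-cong-local; map-++; map-∘; map-applyUpTo; map-upTo; upTo-∷ʳ; map-tabulate)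
open import Data.List.Relation.Unary.All as All using (All)
open import Data.List.Relation.Unary.All.Properties using (all-upTo)
open import Data.Maybe using (Maybe; nothing; just; fromMaybe)
import Data.Maybe as Maybe
open import Data.Nat as ℕ using (ℕ; zero; suc; _+_; _*_; _≤_; _<_; z≤n; s≤s; _≡ᵇ_; _≤ᵇ_; _∸_)
open import Data.Nat.ListAction using (sum)
open import Data.Nat.ListAction.Properties using (sum-++)
open import Data.Nat.Properties
open import Data.Nat.Tactic.RingSolver using (solve-∀)
open import Data.Product using (Σ-syntax; _,_; proj₁)
open import Function using (_∘_; Equivalence)
open import Relation.Binary.PropositionalEquality
open import Relation.Nullary using (¬_; yes; no)

open CommSemigroup +-commutativeSemigroup using (interchange)

private
  variable
    A B : Set
    f g : A → ℕ
    xs : List A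
    k m n x : ℕ
    ls ls′ : List ℕ

T⇒≡true : ∀ {b} → T b → b ≡ true
T⇒≡true = Equivalence.to T-≡

¬T⇒≡false : ∀ {b} → ¬ T b → b ≡ false
¬T⇒≡false {false} _  = refl
¬T⇒≡false {true}  ¬t = ⊥-elim (¬t _)

≡ᵇ-refl : ∀ n → (n ≡ᵇ n) ≡ true
≡ᵇ-refl n = T⇒≡true (≡⇒≡ᵇ n n refl)

≢⇒≡ᵇ≡false : m ≢ n → (m ≡ᵇ n) ≡ false
≢⇒≡ᵇ≡false m≢n = ¬T⇒≡false (m≢n ∘ ≡ᵇ⇒≡ _ _)

≤⇒≤ᵇ≡true : m ≤ n → (m ≤ᵇ n) ≡ true
≤⇒≤ᵇ≡true = T⇒≡true ∘ ≤⇒≤ᵇ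

>⇒≤ᵇ≡false : n < m → (m ≤ᵇ n) ≡ false
>⇒≤ᵇ≡false n<m = ¬T⇒≡false (<⇒≱ n<m ∘ ≤ᵇ⇒≤ _ _)

and-upTo-suc : ∀ n (p : ℕ → Bool) → and (map p (upTo (suc n))) ≡ and (map p (upTo n)) ∧ p n
and-upTo-suc n p = begin
  and (map p (upTo (suc n)))                ≡⟨ cong (and ∘ map p) (upTo-∷ʳ n) ⟨
  and (map p (upTo n ++ n ∷ []))            ≡⟨ cong and (map-++ p (upTo n) (n ∷ [])) ⟩
  and (map p (upTo n) ++ p n ∷ [])          ≡⟨ and-snoc (map p (upTo n)) ⟩
  and (map p (upTo n)) ∧ p n                ∎
  where
  open ≡-Reasoning
  and-snoc : ∀ bs → and (bs ++ p n ∷ []) ≡ and bs ∧ p n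
  and-snoc []       = ∧-identityʳ (p n)
  and-snoc (b ∷ bs) = trans (cong (b ∧_) (and-snoc bs)) (sym (∧-assoc b _ _))

𝟙 : Bool → ℕ
𝟙 true  = 1
𝟙 false = 0

𝟙-∧ : ∀ b c y → 𝟙 (b ∧ c) * y ≡ 𝟙 b * (𝟙 c * y)
𝟙-∧ true  c y = sym (+-identityʳ (𝟙 c * y))
𝟙-∧ false c y = refl

sumBy : (A → ℕ) → List A → ℕ
sumBy f xs = sum (map f xs)

sumBy-cong : f ≗ g → ∀ xs → sumBy f xs ≡ sumBy g xs
sumBy-cong f≗g xs = cong sum (map-cong f≗g xs)

sumBy-cong-local : All (λ x → f x ≡ g x) xs → sumBy f xs ≡ sumBy g xs
sumBy-cong-local eqs = cong sum (map-cong-local eqs)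

sumBy-zero : ∀ (xs : List A) → sumBy (λ _ → 0) xs ≡ 0
sumBy-zero []       = refl
sumBy-zero (x ∷ xs) = sumBy-zero xs

sumBy-++ : ∀ (f : A → ℕ) xs ys → sumBy f (xs ++ ys) ≡ sumBy f xs + sumBy f ys
sumBy-++ f xs ys = trans (cong sum (map-++ f xs ys)) (sum-++ (map f xs) (map f ys))

sumBy-map : ∀ (f : B → ℕ) (g : A → B) xs → sumBy f (map g xs) ≡ sumBy (f ∘ g) xs
sumBy-map f g xs = cong sum (sym (map-∘ xs))

sumBy-concatMap : ∀ (f : B → ℕ) (g : A → List B) xs →
                  sumBy f (concatMap g xs) ≡ sumBy (sumBy f ∘ g) xs
sumBy-concatMap f g []       = refl
sumBy-concatMap f g (x ∷ xs) =
  trans (sumBy-++ f (g x) (concatMap g xs)) (cong (_+_ (sumBy f (g x))) (sumBy-concatMap f g xs))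

sumBy-+ : ∀ (f g : A → ℕ) xs → sumBy (λ x → f x + g x) xs ≡ sumBy f xs + sumBy g xs
sumBy-+ f g []       = refl
sumBy-+ f g (x ∷ xs) =
  trans (cong (_+_ (f x + g x)) (sumBy-+ f g xs)) (interchange (f x) (g x) (sumBy f xs) (sumBy g xs))

sumBy-*ˡ : ∀ a (f : A → ℕ) xs → sumBy (λ x → a * f x) xs ≡ a * sumBy f xs
sumBy-*ˡ a f []       = sym (*-zeroʳ a)
sumBy-*ˡ a f (x ∷ xs) =
  trans (cong (_+_ (a * f x)) (sumBy-*ˡ a f xs)) (sym (*-distribˡ-+ a (f x) (sumBy f xs)))

sumBy-comm : ∀ (f : A → B → ℕ) xs ys →
             sumBy (λ x → sumBy (f x) ys) xs ≡ sumBy (λ y → sumBy (λ x → f x y) xs) ys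
sumBy-comm f []       ys = sym (sumBy-zero ys)
sumBy-comm f (x ∷ xs) ys =
  trans (cong (_+_ (sumBy (f x) ys)) (sumBy-comm f xs ys))
        (sym (sumBy-+ (f x) (λ y → sumBy (λ x → f x y) xs) ys))

sumBy-filterᵇ : ∀ (f : A → ℕ) p xs → sumBy f (filterᵇ p xs) ≡ sumBy (λ x → 𝟙 (p x) * f x) xs
sumBy-filterᵇ f p []       = refl
sumBy-filterᵇ f p (x ∷ xs) with p x
... | true  = cong₂ _+_ (sym (+-identityʳ (f x))) (sumBy-filterᵇ f p xs)
... | false = sumBy-filterᵇ f p xs

length-filterᵇ : ∀ (p : A → Bool) xs → length (filterᵇ p xs) ≡ sumBy (𝟙 ∘ p) xs
length-filterᵇ p []       = refl
length-filterᵇ p (x ∷ xs) with p x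
... | true  = cong suc (length-filterᵇ p xs)
... | false = length-filterᵇ p xs

∑< : ℕ → (ℕ → ℕ) → ℕ
∑< n f = sumBy f (upTo n)

∑<-suc : ∀ n f → ∑< (suc n) f ≡ f 0 + ∑< n (f ∘ suc)
∑<-suc n f = cong (λ xs → f 0 + sum xs) (trans (map-applyUpTo suc f n) (sym (map-upTo (f ∘ suc) n)))

∑<-snoc : ∀ n f → ∑< (suc n) f ≡ ∑< n f + f n
∑<-snoc n f = begin
  ∑< (suc n) f               ≡⟨ cong (sumBy f) (upTo-∷ʳ n) ⟨
  sumBy f (upTo n ++ n ∷ [])  ≡⟨ sumBy-++ f (upTo n) (n ∷ []) ⟩
  ∑< n f + (f n + 0)          ≡⟨ cong (_+_ (∑< n f)) (+-identityʳ (f n)) ⟩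
  ∑< n f + f n                ∎
  where open ≡-Reasoning

∑<-cong : ∀ n → (∀ {i} → i < n → f i ≡ g i) → ∑< n f ≡ ∑< n g
∑<-cong n eq = sumBy-cong-local (All.map eq (all-upTo n))

∑<-zero : ∀ n → (∀ {i} → i < n → f i ≡ 0) → ∑< n f ≡ 0
∑<-zero n eq = trans (∑<-cong n eq) (sumBy-zero (upTo n))

sumBy-allFin : ∀ n (f : ℕ → ℕ) → sumBy (f ∘ toℕ) (allFin n) ≡ ∑< n f
sumBy-allFin n f = trans (sym (sumBy-map f toℕ (allFin n))) (cong (sumBy f) (map-toℕ-allFin n))
  where
  map-toℕ-allFin : ∀ n → map toℕ (allFin n) ≡ upTo n
  map-toℕ-allFin zero    = refl
  map-toℕ-allFin (suc n) = cong (0 ∷_) (begin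
    map toℕ (tabulate Fin.suc)          ≡⟨ map-tabulate Fin.suc toℕ ⟩
    tabulate (suc ∘ toℕ)                ≡⟨ map-tabulate (λ i → i) (suc ∘ toℕ) ⟨
    map (suc ∘ toℕ) (allFin n)          ≡⟨ map-∘ (allFin n) ⟩
    map suc (map toℕ (allFin n))        ≡⟨ cong (map suc) (map-toℕ-allFin n) ⟩
    map suc (upTo n)                    ≡⟨ map-upTo suc n ⟩
    applyUpTo suc n                     ∎)
    where open ≡-Reasoning

-- Rising factorial coefficients and Stirling numbers

-- The coefficient of xᵐ in (x + p)(x + p + 1)⋯(x + p + q - 1), expanded along its first factor.
risingCoeff : ℕ → ℕ → ℕ → ℕ
risingCoeff p zero    zero    = 1
risingCoeff p zero    (suc m) = 0
risingCoeff p (suc q) zero    = p * risingCoeff (suc p) q zero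
risingCoeff p (suc q) (suc m) = p * risingCoeff (suc p) q (suc m) + risingCoeff (suc p) q m

risingCoeff-vanish : ∀ p q m → q < m → risingCoeff p q m ≡ 0
risingCoeff-vanish p zero    (suc m) _ = refl
risingCoeff-vanish p (suc q) (suc m) (s≤s q<m)
  rewrite risingCoeff-vanish (suc p) q (suc m) (m≤n⇒m≤1+n q<m)
        | risingCoeff-vanish (suc p) q m q<m = trans (+-identityʳ (p * 0)) (*-zeroʳ p)

risingCoeff-zero-indep : ∀ p p′ m → risingCoeff p 0 m ≡ risingCoeff p′ 0 m
risingCoeff-zero-indep p p′ zero    = refl
risingCoeff-zero-indep p p′ (suc m) = refl

risingCoeff-suc-zero : ∀ p q → risingCoeff p (suc q) 0 ≡ (p + q) * risingCoeff p q 0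
risingCoeff-suc-zero p zero    = cong (_* 1) (sym (+-identityʳ p))
risingCoeff-suc-zero p (suc q)
  rewrite risingCoeff-suc-zero (suc p) q | +-suc p q = lemma p q (risingCoeff (suc p) q 0)
  where
  lemma : ∀ p q c → p * (suc (p + q) * c) ≡ suc (p + q) * (p * c)
  lemma = solve-∀

risingCoeff-suc-suc : ∀ p q m →
  risingCoeff p (suc q) (suc m) ≡ (p + q) * risingCoeff p q (suc m) + risingCoeff p q m
risingCoeff-suc-suc p zero m =
  cong₂ _+_ (trans (*-zeroʳ p) (sym (*-zeroʳ (p + 0)))) (risingCoeff-zero-indep (suc p) p m)
risingCoeff-suc-suc p (suc q) zero
  rewrite risingCoeff-suc-suc (suc p) q 0 | risingCoeff-suc-zero (suc p) q | +-suc p q =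
  lemma p q (risingCoeff (suc p) q 1) (risingCoeff (suc p) q 0)
  where
  lemma : ∀ p q a b → p * (suc (p + q) * a + b) + suc (p + q) * b ≡ suc (p + q) * (p * a + b) + p * b
  lemma = solve-∀
risingCoeff-suc-suc p (suc q) (suc m)
  rewrite risingCoeff-suc-suc (suc p) q (suc m) | risingCoeff-suc-suc (suc p) q m | +-suc p q =
  lemma p q (risingCoeff (suc p) q (suc (suc m))) (risingCoeff (suc p) q (suc m)) (risingCoeff (suc p) q m)
  where
  lemma : ∀ p q a b c →
    p * (suc (p + q) * a + b) + (suc (p + q) * b + c) ≡ suc (p + q) * (p * a + b) + (p * b + c)
  lemma = solve-∀

-- addP is local to the where block of mulXminus and can only be reached by abstracting
-- over its arguments, so the statement of coeff-addP is inferred from its single use.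
mutual
  coeff-mulXminus : ∀ a p b →
    coeff (mulXminus a p) b ≡ coeff (+ 0 ∷ p) b ℤ.+ coeff (map (λ c → - (+ a ℤ.* c)) p) b
  coeff-mulXminus a p b with + 0 ∷ p | map (λ c → - (+ a ℤ.* c)) p
  ... | xs | ys = coeff-addP a p xs ys b

  coeff-addP : (a : ℕ) (p xs ys : List ℤ) (b : ℕ) → _
  coeff-addP a p []       ys       b       = sym (ℤ.+-identityˡ _)
  coeff-addP a p (x ∷ xs) []       b       = sym (ℤ.+-identityʳ _)
  coeff-addP a p (x ∷ xs) (y ∷ ys) zero    = refl
  coeff-addP a p (x ∷ xs) (y ∷ ys) (suc b) = coeff-addP a p xs ys b

coeff-map : ∀ (f : ℤ → ℤ) → f (+ 0) ≡ + 0 → ∀ xs b → coeff (map f xs) b ≡ f (coeff xs b)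
coeff-map f f0 []       b       = sym f0
coeff-map f f0 (x ∷ xs) zero    = refl
coeff-map f f0 (x ∷ xs) (suc b) = coeff-map f f0 xs b

s-suc : ∀ n b → s (suc n) b ≡ coeff (+ 0 ∷ falling n) b ℤ.- + n ℤ.* s n b
s-suc n b =
  trans (coeff-mulXminus n (falling n) b)
        (cong (ℤ._+_ (coeff (+ 0 ∷ falling n) b)) (coeff-map (λ c → - (+ n ℤ.* c)) negate-zero (falling n) b))
  where
  negate-zero : - (+ n ℤ.* + 0) ≡ + 0
  negate-zero = cong -_ (ℤ.*-zeroʳ (+ n))

sign : ℕ → ℤ
sign i = (- (+ 1)) ^ i

sign-+ : ∀ m n → sign (m + n) ≡ sign m ℤ.* sign n
sign-+ = ℤ.^-distribˡ-+-* (- (+ 1))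

sign-*-self : ∀ n → sign n ℤ.* sign n ≡ + 1
sign-*-self zero    = refl
sign-*-self (suc n) = trans (lemma (sign n)) (sign-*-self n)
  where
  lemma : ∀ σ → (- (+ 1) ℤ.* σ) ℤ.* (- (+ 1) ℤ.* σ) ≡ σ ℤ.* σ
  lemma = ℤ-Solver.solve-∀

s≡sign*risingCoeff : ∀ n m → s n m ≡ sign (n + m) ℤ.* + risingCoeff 0 n m
s≡sign*risingCoeff zero    zero    = refl
s≡sign*risingCoeff zero    (suc m) = sym (ℤ.*-zeroʳ (sign (suc m)))
s≡sign*risingCoeff (suc n) zero    = begin
  s (suc n) 0                                        ≡⟨ s-suc n 0 ⟩
  + 0 ℤ.- + n ℤ.* s n 0                              ≡⟨ cong (λ z → + 0 ℤ.- + n ℤ.* z) (s≡sign*risingCoeff n 0) ⟩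
  + 0 ℤ.- + n ℤ.* (sign (n + 0) ℤ.* + c)             ≡⟨ lemma (+ n) (sign (n + 0)) (+ c) ⟩
  sign (suc n + 0) ℤ.* (+ n ℤ.* + c)                 ≡⟨ cong (sign (suc n + 0) ℤ.*_) (ℤ.pos-* n c) ⟨
  sign (suc n + 0) ℤ.* + (n * c)                     ≡⟨ cong (λ z → sign (suc n + 0) ℤ.* + z) (risingCoeff-suc-zero 0 n) ⟨
  sign (suc n + 0) ℤ.* + risingCoeff 0 (suc n) 0     ∎
  where
  open ≡-Reasoning
  c = risingCoeff 0 n 0
  lemma : ∀ ν σ γ → + 0 ℤ.- ν ℤ.* (σ ℤ.* γ) ≡ (- (+ 1) ℤ.* σ) ℤ.* (ν ℤ.* γ)
  lemma = ℤ-Solver.solve-∀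
s≡sign*risingCoeff (suc n) (suc m) = begin
  s (suc n) (suc m)                                  ≡⟨ s-suc n (suc m) ⟩
  s n m ℤ.- + n ℤ.* s n (suc m)                      ≡⟨ cong₂ (λ y z → y ℤ.- + n ℤ.* z) (s≡sign*risingCoeff n m) (s≡sign*risingCoeff n (suc m)) ⟩
  σ ℤ.* + a ℤ.- + n ℤ.* (sign (n + suc m) ℤ.* + b)   ≡⟨ cong (λ i → σ ℤ.* + a ℤ.- + n ℤ.* (sign i ℤ.* + b)) (+-suc n m) ⟩
  σ ℤ.* + a ℤ.- + n ℤ.* (- (+ 1) ℤ.* σ ℤ.* + b)      ≡⟨ lemma (+ n) σ (+ a) (+ b) ⟩
  - (+ 1) ℤ.* (- (+ 1) ℤ.* σ) ℤ.* (+ n ℤ.* + b ℤ.+ + a) ≡⟨ cong₂ ℤ._*_ (cong (λ i → - (+ 1) ℤ.* sign i) (sym (+-suc n m))) (sym pos-recurrence) ⟩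
  sign (suc n + suc m) ℤ.* + risingCoeff 0 (suc n) (suc m) ∎
  where
  open ≡-Reasoning
  σ = sign (n + m)
  a = risingCoeff 0 n m
  b = risingCoeff 0 n (suc m)
  pos-recurrence : + risingCoeff 0 (suc n) (suc m) ≡ + n ℤ.* + b ℤ.+ + a
  pos-recurrence = begin
    + risingCoeff 0 (suc n) (suc m)  ≡⟨ cong +_ (risingCoeff-suc-suc 0 n m) ⟩
    + (n * b + a)                    ≡⟨ ℤ.pos-+ (n * b) a ⟩
    + (n * b) ℤ.+ + a                ≡⟨ cong (ℤ._+ + a) (ℤ.pos-* n b) ⟩
    + n ℤ.* + b ℤ.+ + a              ∎
  lemma : ∀ ν σ α β → σ ℤ.* α ℤ.- ν ℤ.* (- (+ 1) ℤ.* σ ℤ.* β) ≡ - (+ 1) ℤ.* (- (+ 1) ℤ.* σ) ℤ.* (ν ℤ.* β ℤ.+ α)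
  lemma = ℤ-Solver.solve-∀

-- Adding points one at a time

sumFrom : ℕ → ℕ → (ℕ → ℕ) → ℕ
sumFrom x k g = ∑< k (λ l → 𝟙 (x ≤ᵇ l) * g l)

sumFrom-cong : ∀ x k {g h : ℕ → ℕ} → (∀ {l} → l < k → g l ≡ h l) → sumFrom x k g ≡ sumFrom x k h
sumFrom-cong x k eq = ∑<-cong k (λ l<k → cong (𝟙 (x ≤ᵇ _) *_) (eq l<k))

sumFrom-suc : ∀ {x k} g → x ≤ k → sumFrom x (suc k) g ≡ sumFrom x k g + g k
sumFrom-suc {x} {k} g x≤k = begin
  sumFrom x (suc k) g               ≡⟨ ∑<-snoc k _ ⟩
  sumFrom x k g + 𝟙 (x ≤ᵇ k) * g k  ≡⟨ cong (λ b → sumFrom x k g + 𝟙 b * g k) (≤⇒≤ᵇ≡true x≤k) ⟩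
  sumFrom x k g + (g k + 0)         ≡⟨ cong (_+_ (sumFrom x k g)) (+-identityʳ (g k)) ⟩
  sumFrom x k g + g k               ∎
  where open ≡-Reasoning

sumFrom-self : ∀ k g → sumFrom k k g ≡ 0
sumFrom-self k g = ∑<-zero k (λ l<k → cong (_* g _) (cong 𝟙 (>⇒≤ᵇ≡false l<k)))

sumFrom-*ˡ : ∀ x k c g → sumFrom x k (λ l → c * g l) ≡ c * sumFrom x k g
sumFrom-*ˡ x k c g = trans (∑<-cong k (λ {l} _ → x*[y*z]≡y*[x*z] (𝟙 (x ≤ᵇ l)) c (g l)))
                           (sumBy-*ˡ c (λ l → 𝟙 (x ≤ᵇ l) * g l) (upTo k))
  where
  x*[y*z]≡y*[x*z] : ∀ a b c → a * (b * c) ≡ b * (a * c)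
  x*[y*z]≡y*[x*z] = solve-∀

sumFrom-∑< : ∀ x k n (h : ℕ → ℕ → ℕ) → sumFrom x k (λ l → ∑< n (h l)) ≡ ∑< n (λ m → sumFrom x k (λ l → h l m))
sumFrom-∑< x k n h = begin
  sumFrom x k (λ l → ∑< n (h l))                     ≡⟨ ∑<-cong k (λ {l} _ → sumBy-*ˡ (𝟙 (x ≤ᵇ l)) (h l) (upTo n)) ⟨
  ∑< k (λ l → ∑< n (λ m → 𝟙 (x ≤ᵇ l) * h l m))       ≡⟨ sumBy-comm (λ l m → 𝟙 (x ≤ᵇ l) * h l m) (upTo k) (upTo n) ⟩
  ∑< n (λ m → sumFrom x k (λ l → h l m))             ∎
  where open ≡-Reasoning

-- extensions k ls q ρ r: the points placed so far have levels ls (the label of the edge into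
-- the point, 0 for a root) and ρ of them are roots; it counts the ways to place q more points,
-- each a new root or the target of an edge from an earlier point of level x with a label l,
-- x ≤ l < k, ending with r roots.
extensions : ℕ → List ℕ → ℕ → ℕ → ℕ → ℕ
extensions k ls zero    ρ r = 𝟙 (ρ ≡ᵇ r)
extensions k ls (suc q) ρ r =
  extensions k (0 ∷ ls) q (suc ρ) r + sumBy (λ x → sumFrom x k (λ l → extensions k (l ∷ ls) q ρ r)) ls

extensions-noLabels : ∀ ls q ρ r → extensions 0 ls q ρ r ≡ 𝟙 (q + ρ ≡ᵇ r)
extensions-noLabels ls zero    ρ r = refl
extensions-noLabels ls (suc q) ρ r = begin
  extensions 0 (0 ∷ ls) q (suc ρ) r + sumBy (λ _ → 0) ls  ≡⟨ cong₂ _+_ (extensions-noLabels (0 ∷ ls) q (suc ρ) r) (sumBy-zero ls) ⟩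
  𝟙 (q + suc ρ ≡ᵇ r) + 0                                  ≡⟨ +-identityʳ _ ⟩
  𝟙 (q + suc ρ ≡ᵇ r)                                      ≡⟨ cong (λ n → 𝟙 (n ≡ᵇ r)) (+-suc q ρ) ⟩
  𝟙 (suc q + ρ ≡ᵇ r)                                      ∎
  where open ≡-Reasoning

extensions-vanish : ∀ k ls q ρ r → q + ρ < r → extensions k ls q ρ r ≡ 0
extensions-vanish k ls zero    ρ r ρ<r = cong 𝟙 (≢⇒≡ᵇ≡false (<⇒≢ ρ<r))
extensions-vanish k ls (suc q) ρ r q+ρ<r = cong₂ _+_
  (extensions-vanish k (0 ∷ ls) q (suc ρ) r (subst (_< r) (sym (+-suc q ρ)) q+ρ<r))
  (trans (sumBy-cong (λ x → sumFrom-cong x k (λ _ → extensions-vanish k _ q ρ r (<-trans (n<1+n _) q+ρ<r))) ls)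
         (trans (sumBy-cong (λ x → ∑<-zero k (λ {l} _ → *-zeroʳ (𝟙 (x ≤ᵇ l)))) ls) (sumBy-zero ls)))

-- All entries of ls are at most k and ls′ is ls with some of the entries k deleted (not all of
-- them: for k = 0 the roots have the top level as well).
data StripTop (k : ℕ) : List ℕ → List ℕ → Set where
  []   : StripTop k [] []
  keep : x ≤ k → StripTop k ls ls′ → StripTop k (x ∷ ls) (x ∷ ls′)
  drop : StripTop k ls ls′ → StripTop k (k ∷ ls) ls′

sumBy-sumFrom-suc : ∀ k g → StripTop k ls ls′ →
  sumBy (λ x → sumFrom x (suc k) g) ls ≡ sumBy (λ x → sumFrom x k g) ls′ + length ls * g k
sumBy-sumFrom-suc k g [] = refl
sumBy-sumFrom-suc k g (keep {x} {ls} {ls′} x≤k st)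
  rewrite sumFrom-suc g x≤k | sumBy-sumFrom-suc k g st =
  lemma (sumFrom x k g) (g k) (sumBy (λ x → sumFrom x k g) ls′) (length ls)
  where
  lemma : ∀ a b c n → a + b + (c + n * b) ≡ a + c + (b + n * b)
  lemma = solve-∀
sumBy-sumFrom-suc k g (drop {ls} {ls′} st)
  rewrite sumFrom-suc g (≤-refl {k}) | sumFrom-self k g | sumBy-sumFrom-suc k g st =
  lemma (g k) (sumBy (λ x → sumFrom x k g) ls′) (length ls)
  where
  lemma : ∀ b c n → b + (c + n * b) ≡ c + (b + n * b)
  lemma = solve-∀

-- extensions (suc k) with the points of the top level k remembered only through p, the
-- number of all points placed so far: any point may receive a new edge labelled k.
extensionsTop : ℕ → List ℕ → ℕ → ℕ → ℕ → ℕ → ℕ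
extensionsTop k ls p zero    ρ r = 𝟙 (ρ ≡ᵇ r)
extensionsTop k ls p (suc q) ρ r =
  p * extensionsTop k ls (suc p) q ρ r
  + (extensionsTop k (0 ∷ ls) (suc p) q (suc ρ) r
     + sumBy (λ x → sumFrom x k (λ l → extensionsTop k (l ∷ ls) (suc p) q ρ r)) ls)

extensions-suc≡extensionsTop : ∀ k q ρ r → StripTop k ls ls′ →
  extensions (suc k) ls q ρ r ≡ extensionsTop k ls′ (length ls) q ρ r
extensions-suc≡extensionsTop k zero    ρ r st = refl
extensions-suc≡extensionsTop {ls} {ls′} k (suc q) ρ r st = begin
  extensions (suc k) (0 ∷ ls) q (suc ρ) r + sumBy (λ x → sumFrom x (suc k) next) ls
    ≡⟨ cong₂ _+_ (extensions-suc≡extensionsTop k q (suc ρ) r (keep z≤n st)) (sumBy-sumFrom-suc k next st) ⟩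
  E′ (0 ∷ ls′) (suc ρ) + (sumBy (λ x → sumFrom x k next) ls′ + p * next k)
    ≡⟨ cong (λ z → E′ (0 ∷ ls′) (suc ρ) + (z + p * next k)) (sumBy-cong (λ x → sumFrom-cong x k strip-level) ls′) ⟩
  E′ (0 ∷ ls′) (suc ρ) + (sumBy (λ x → sumFrom x k (λ l → E′ (l ∷ ls′) ρ)) ls′ + p * next k)
    ≡⟨ cong (λ z → E′ (0 ∷ ls′) (suc ρ) + (sumBy (λ x → sumFrom x k (λ l → E′ (l ∷ ls′) ρ)) ls′ + p * z))
            (extensions-suc≡extensionsTop k q ρ r (drop st)) ⟩
  E′ (0 ∷ ls′) (suc ρ) + (sumBy (λ x → sumFrom x k (λ l → E′ (l ∷ ls′) ρ)) ls′ + p * E′ ls′ ρ)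
    ≡⟨ lemma (E′ (0 ∷ ls′) (suc ρ)) (sumBy (λ x → sumFrom x k (λ l → E′ (l ∷ ls′) ρ)) ls′) (p * E′ ls′ ρ) ⟩
  p * E′ ls′ ρ + (E′ (0 ∷ ls′) (suc ρ) + sumBy (λ x → sumFrom x k (λ l → E′ (l ∷ ls′) ρ)) ls′)
    ∎
  where
  open ≡-Reasoning
  p = length ls
  next : ℕ → ℕ
  next l = extensions (suc k) (l ∷ ls) q ρ r
  E′ : List ℕ → ℕ → ℕ
  E′ ls″ ρ′ = extensionsTop k ls″ (suc p) q ρ′ r
  strip-level : ∀ {l} → l < k → next l ≡ E′ (l ∷ ls′) ρ
  strip-level l<k = extensions-suc≡extensionsTop k q ρ r (keep (<⇒≤ l<k) st)
  lemma : ∀ a b c → a + (b + c) ≡ c + (a + b)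
  lemma = solve-∀

∑<-suc-vanishing : ∀ q (h : ℕ → ℕ) → h (suc q) ≡ 0 → ∑< (suc q) h ≡ h 0 + ∑< (suc q) (h ∘ suc)
∑<-suc-vanishing q h h0 = begin
  ∑< (suc q) h                        ≡⟨ ∑<-suc q h ⟩
  h 0 + ∑< q (h ∘ suc)                ≡⟨ cong (_+_ (h 0)) (+-identityʳ _) ⟨
  h 0 + (∑< q (h ∘ suc) + 0)          ≡⟨ cong (λ z → h 0 + (∑< q (h ∘ suc) + z)) h0 ⟨
  h 0 + (∑< q (h ∘ suc) + h (suc q))  ≡⟨ cong (_+_ (h 0)) (∑<-snoc q (h ∘ suc)) ⟨
  h 0 + ∑< (suc q) (h ∘ suc)          ∎
  where open ≡-Reasoning

∑<-*-extensions-suc : ∀ k ls ρ r N (C : ℕ → ℕ) →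
    ∑< N (λ m → C m * extensions k (0 ∷ ls) m (suc ρ) r)
  + sumBy (λ x → sumFrom x k (λ l → ∑< N (λ m → C m * extensions k (l ∷ ls) m ρ r))) ls
  ≡ ∑< N (λ m → C m * extensions k ls (suc m) ρ r)
∑<-*-extensions-suc k ls ρ r N C = begin
  ∑< N (λ m → C m * E 0 m (suc ρ)) + sumBy (λ x → sumFrom x k (λ l → ∑< N (λ m → C m * E l m ρ))) ls
    ≡⟨ cong (_+_ (∑< N (λ m → C m * E 0 m (suc ρ)))) (begin
         sumBy (λ x → sumFrom x k (λ l → ∑< N (λ m → C m * E l m ρ))) ls
           ≡⟨ sumBy-cong (λ x → sumFrom-∑< x k N (λ l m → C m * E l m ρ)) ls ⟩
         sumBy (λ x → ∑< N (λ m → sumFrom x k (λ l → C m * E l m ρ))) ls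
           ≡⟨ sumBy-cong (λ x → sumBy-cong (λ m → sumFrom-*ˡ x k (C m) (λ l → E l m ρ)) (upTo N)) ls ⟩
         sumBy (λ x → ∑< N (λ m → C m * sumFrom x k (λ l → E l m ρ))) ls
           ≡⟨ sumBy-comm (λ x m → C m * sumFrom x k (λ l → E l m ρ)) ls (upTo N) ⟩
         ∑< N (λ m → sumBy (λ x → C m * sumFrom x k (λ l → E l m ρ)) ls)
           ≡⟨ sumBy-cong (λ m → sumBy-*ˡ (C m) (λ x → sumFrom x k (λ l → E l m ρ)) ls) (upTo N) ⟩
         ∑< N (λ m → C m * sumBy (λ x → sumFrom x k (λ l → E l m ρ)) ls)
           ∎) ⟩
  ∑< N (λ m → C m * E 0 m (suc ρ)) + ∑< N (λ m → C m * sumBy (λ x → sumFrom x k (λ l → E l m ρ)) ls)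
    ≡⟨ sumBy-+ (λ m → C m * E 0 m (suc ρ)) (λ m → C m * sumBy (λ x → sumFrom x k (λ l → E l m ρ)) ls) (upTo N) ⟨
  ∑< N (λ m → C m * E 0 m (suc ρ) + C m * sumBy (λ x → sumFrom x k (λ l → E l m ρ)) ls)
    ≡⟨ sumBy-cong (λ m → *-distribˡ-+ (C m) _ _) (upTo N) ⟨
  ∑< N (λ m → C m * extensions k ls (suc m) ρ r)
    ∎
  where
  open ≡-Reasoning
  E : ℕ → ℕ → ℕ → ℕ
  E l m ρ′ = extensions k (l ∷ ls) m ρ′ r

-- A new point of top level has p choices of source, p the number of points before it; over q
-- steps these choices produce the coefficients of (x + p)(x + p + 1)⋯(x + p + q - 1).
extensionsTop≡∑ : ∀ k ls p q ρ r →
  extensionsTop k ls p q ρ r ≡ ∑< (suc q) (λ m → risingCoeff p q m * extensions k ls m ρ r)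
extensionsTop≡∑ k ls p zero    ρ r = sym (trans (+-identityʳ _) (+-identityʳ _))
extensionsTop≡∑ k ls p (suc q) ρ r = begin
  p * extensionsTop k ls (suc p) q ρ r
    + (extensionsTop k (0 ∷ ls) (suc p) q (suc ρ) r
       + sumBy (λ x → sumFrom x k (λ l → extensionsTop k (l ∷ ls) (suc p) q ρ r)) ls)
    ≡⟨ cong₂ (λ u v → p * u + v) (extensionsTop≡∑ k ls (suc p) q ρ r)
             (cong₂ _+_ (extensionsTop≡∑ k (0 ∷ ls) (suc p) q (suc ρ) r)
                        (sumBy-cong (λ x → sumFrom-cong x k (λ {l} _ → extensionsTop≡∑ k (l ∷ ls) (suc p) q ρ r)) ls)) ⟩
  p * ∑< N (λ m → C m * X m)
    + (∑< N (λ m → C m * extensions k (0 ∷ ls) m (suc ρ) r)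
       + sumBy (λ x → sumFrom x k (λ l → ∑< N (λ m → C m * extensions k (l ∷ ls) m ρ r))) ls)
    ≡⟨ cong (_+_ (p * ∑< N (λ m → C m * X m))) (∑<-*-extensions-suc k ls ρ r N C) ⟩
  p * ∑< N (λ m → C m * X m) + ∑< N (λ m → C m * X (suc m))
    ≡⟨ cong (λ z → p * z + ∑< N (λ m → C m * X (suc m)))
            (∑<-suc-vanishing q (λ m → C m * X m) (cong (_* X N) (risingCoeff-vanish (suc p) q N ≤-refl))) ⟩
  p * (C 0 * X 0 + ∑< N (λ m → C (suc m) * X (suc m))) + ∑< N (λ m → C m * X (suc m))
    ≡⟨ regroup p (C 0) (X 0) (∑< N (λ m → C (suc m) * X (suc m))) (∑< N (λ m → C m * X (suc m))) ⟩
  p * C 0 * X 0 + (p * ∑< N (λ m → C (suc m) * X (suc m)) + ∑< N (λ m → C m * X (suc m)))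
    ≡⟨ cong (_+_ (p * C 0 * X 0)) merge ⟩
  p * C 0 * X 0 + ∑< N (λ m → (p * C (suc m) + C m) * X (suc m))
    ≡⟨ ∑<-suc N (λ m → risingCoeff p N m * X m) ⟨
  ∑< (suc N) (λ m → risingCoeff p N m * X m)
    ∎
  where
  open ≡-Reasoning
  N = suc q
  C X : ℕ → ℕ
  C m = risingCoeff (suc p) q m
  X m = extensions k ls m ρ r

  regroup : ∀ p a x b c → p * (a * x + b) + c ≡ p * a * x + (p * b + c)
  regroup = solve-∀

  merge : p * ∑< N (λ m → C (suc m) * X (suc m)) + ∑< N (λ m → C m * X (suc m))
        ≡ ∑< N (λ m → (p * C (suc m) + C m) * X (suc m))
  merge = begin
    p * ∑< N (λ m → C (suc m) * X (suc m)) + ∑< N (λ m → C m * X (suc m))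
      ≡⟨ cong (_+ ∑< N (λ m → C m * X (suc m))) (sumBy-*ˡ p (λ m → C (suc m) * X (suc m)) (upTo N)) ⟨
    ∑< N (λ m → p * (C (suc m) * X (suc m))) + ∑< N (λ m → C m * X (suc m))
      ≡⟨ sumBy-+ (λ m → p * (C (suc m) * X (suc m))) (λ m → C m * X (suc m)) (upTo N) ⟨
    ∑< N (λ m → p * (C (suc m) * X (suc m)) + C m * X (suc m))
      ≡⟨ sumBy-cong (λ m → lemma (C (suc m)) (C m) (X (suc m))) (upTo N) ⟩
    ∑< N (λ m → (p * C (suc m) + C m) * X (suc m))
      ∎
    where
    lemma : ∀ c c′ x → p * (c * x) + c′ * x ≡ (p * c + c′) * x
    lemma c c′ x = trans (cong (_+ c′ * x) (sym (*-assoc p c x))) (sym (*-distribʳ-+ x (p * c) c′))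

extensions-suc : ∀ k n r → extensions (suc k) [] n 0 r ≡ ∑< (suc n) (λ m → risingCoeff 0 n m * extensions k [] m 0 r)
extensions-suc k n r = trans (extensions-suc≡extensionsTop k n 0 r []) (extensionsTop≡∑ k [] 0 n 0 r)

-- Diagrams, labelings and levels

parentOf-▸-< : ∀ (D : Diagram n) x → m < n → parentOf (D ▸ x) m ≡ parentOf D m
parentOf-▸-< D x m<n rewrite ≢⇒≡ᵇ≡false (<⇒≢ m<n) = refl

parentOf-▸-new : ∀ (D : Diagram n) x → parentOf (D ▸ x) n ≡ Maybe.map toℕ x
parentOf-▸-new {n} D x rewrite ≡ᵇ-refl n = refl

parentOf<n : ∀ (D : Diagram n) m {j} → parentOf D m ≡ just j → j < n
parentOf<n (_▸_ {n} D x) m eq with m ≡ᵇ n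
parentOf<n (D ▸ just i) m refl | true  = m≤n⇒m≤1+n (toℕ<n i)
... | false = m≤n⇒m≤1+n (parentOf<n D m eq)

labelOf-≥ : ∀ (D : Diagram n) (c : Labeling k D) → n ≤ m → labelOf D c m ≡ nothing
labelOf-≥ []              c       _   = refl
labelOf-≥ (D ▸ nothing)   c       n≤m = labelOf-≥ D c (<⇒≤ n≤m)
labelOf-≥ (D ▸ just _)    (c , l) n≤m
  rewrite ≢⇒≡ᵇ≡false (≢-sym (<⇒≢ n≤m)) = labelOf-≥ D c (<⇒≤ n≤m)

labelOf-▸-< : ∀ (D : Diagram n) j (c : Labeling k D) l → m < n →
  labelOf (D ▸ just j) (c , l) m ≡ labelOf D c m
labelOf-▸-< D j c l m<n rewrite ≢⇒≡ᵇ≡false (<⇒≢ m<n) = refl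

labelOf-▸-new : ∀ (D : Diagram n) j (c : Labeling k D) l → labelOf (D ▸ just j) (c , l) n ≡ just (toℕ l)
labelOf-▸-new {n} D j c l rewrite ≡ᵇ-refl n = refl

labelsOk : Maybe ℕ → Maybe ℕ → Bool
labelsOk (just a) (just b)  = a ≤ᵇ b
labelsOk (just a) nothing   = true
labelsOk nothing  _         = true

edgeOk : Maybe ℕ → (ℕ → Maybe ℕ) → ℕ → Bool
edgeOk nothing  label m = true
edgeOk (just j) label m = labelsOk (label j) (label m)

labelingOkAt : ∀ (D : Diagram n) → Labeling k D → ℕ → Bool
labelingOkAt D c m = edgeOk (parentOf D m) (labelOf D c) m

-- The test isLabeling applies to each point is local to its where block; this exposes it.
labelingTest : ∀ (D : Diagram n) (c : Labeling k D) → Σ[ test ∈ (ℕ → Bool) ] isLabeling D c ≡ and (map test (upTo n))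
labelingTest D c = _ , refl

labelingTest≗labelingOkAt : ∀ (D : Diagram n) (c : Labeling k D) m →
  proj₁ (labelingTest D c) m ≡ labelingOkAt D c m
labelingTest≗labelingOkAt D c m with parentOf D m
... | nothing = refl
... | just j with labelOf D c j | labelOf D c m
...   | just a  | just b  = refl
...   | just a  | nothing = refl
...   | nothing | just b  = refl
...   | nothing | nothing = refl

isLabeling≡and-labelingOkAt : ∀ (D : Diagram n) (c : Labeling k D) →
  isLabeling D c ≡ and (map (labelingOkAt D c) (upTo n))
isLabeling≡and-labelingOkAt {n} D c = cong and (map-cong (labelingTest≗labelingOkAt D c) (upTo n))

isLabeling-▸ : ∀ (D : Diagram n) x (c : Labeling k D) (c′ : Labeling k (D ▸ x)) →
  (∀ {m} → m < n → labelOf (D ▸ x) c′ m ≡ labelOf D c m) →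
  isLabeling (D ▸ x) c′ ≡ isLabeling D c ∧ labelingOkAt (D ▸ x) c′ n
isLabeling-▸ {n} D x c c′ sameLabels = begin
  isLabeling (D ▸ x) c′
    ≡⟨ isLabeling≡and-labelingOkAt (D ▸ x) c′ ⟩
  and (map (labelingOkAt (D ▸ x) c′) (upTo (suc n)))
    ≡⟨ and-upTo-suc n _ ⟩
  and (map (labelingOkAt (D ▸ x) c′) (upTo n)) ∧ _
    ≡⟨ cong (_∧ _) (cong and (map-cong-local (All.map earlierPointsOk (all-upTo n)))) ⟩
  and (map (labelingOkAt D c) (upTo n)) ∧ _
    ≡⟨ cong (_∧ _) (isLabeling≡and-labelingOkAt D c) ⟨
  isLabeling D c ∧ labelingOkAt (D ▸ x) c′ n
    ∎
  where
  open ≡-Reasoning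
  earlierPointsOk : ∀ {m} → m < n → labelingOkAt (D ▸ x) c′ m ≡ labelingOkAt D c m
  earlierPointsOk {m} m<n rewrite parentOf-▸-< D x m<n with parentOf D m in eq
  ... | nothing = refl
  ... | just j  = cong₂ labelsOk (sameLabels (parentOf<n D m eq)) (sameLabels m<n)

isLabeling-▸nothing : ∀ (D : Diagram n) (c : Labeling k D) → isLabeling (D ▸ nothing) c ≡ isLabeling D c
isLabeling-▸nothing {n} D c = begin
  isLabeling (D ▸ nothing) c                 ≡⟨ isLabeling-▸ D nothing c c (λ _ → refl) ⟩
  isLabeling D c ∧ labelingOkAt (D ▸ nothing) c n
    ≡⟨ cong (λ p → isLabeling D c ∧ edgeOk p (labelOf D c) n) (parentOf-▸-new D nothing) ⟩
  isLabeling D c ∧ true                      ≡⟨ ∧-identityʳ _ ⟩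
  isLabeling D c                             ∎
  where open ≡-Reasoning

level : ∀ (D : Diagram n) → Labeling k D → ℕ → ℕ
level D c m = fromMaybe 0 (labelOf D c m)

isLabeling-▸just : ∀ (D : Diagram n) j (c : Labeling k D) l →
  isLabeling (D ▸ just j) (c , l) ≡ isLabeling D c ∧ (level D c (toℕ j) ≤ᵇ toℕ l)
isLabeling-▸just {n} D j c l = begin
  isLabeling (D ▸ just j) (c , l)
    ≡⟨ isLabeling-▸ D (just j) c (c , l) (labelOf-▸-< D j c l) ⟩
  isLabeling D c ∧ labelingOkAt (D ▸ just j) (c , l) n
    ≡⟨ cong (λ p → isLabeling D c ∧ edgeOk p (labelOf (D ▸ just j) (c , l)) n) (parentOf-▸-new D (just j)) ⟩
  isLabeling D c ∧ labelsOk (labelOf (D ▸ just j) (c , l) (toℕ j)) (labelOf (D ▸ just j) (c , l) n)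
    ≡⟨ cong₂ (λ a b → isLabeling D c ∧ labelsOk a b) (labelOf-▸-< D j c l (toℕ<n j)) (labelOf-▸-new D j c l) ⟩
  isLabeling D c ∧ labelsOk (labelOf D c (toℕ j)) (just (toℕ l))
    ≡⟨ cong (isLabeling D c ∧_) (labelsOk-just (labelOf D c (toℕ j))) ⟩
  isLabeling D c ∧ (level D c (toℕ j) ≤ᵇ toℕ l)
    ∎
  where
  open ≡-Reasoning
  labelsOk-just : ∀ a → labelsOk a (just (toℕ l)) ≡ (fromMaybe 0 a ≤ᵇ toℕ l)
  labelsOk-just nothing  = refl
  labelsOk-just (just a) = refl

levels : ∀ (D : Diagram n) → Labeling k D → List ℕ
levels []            c       = []
levels (D ▸ nothing) c       = 0 ∷ levels D c
levels (D ▸ just _)  (c , l) = toℕ l ∷ levels D c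

roots : Diagram n → ℕ
roots []            = 0
roots (D ▸ nothing) = suc (roots D)
roots (D ▸ just _)  = roots D

edges+roots : ∀ (D : Diagram n) → edges D + roots D ≡ n
edges+roots []            = refl
edges+roots (D ▸ nothing) = trans (+-suc (edges D) (roots D)) (cong suc (edges+roots D))
edges+roots (D ▸ just _)  = cong suc (edges+roots D)

∑<-level : ∀ (D : Diagram n) (c : Labeling k D) (h : ℕ → ℕ) → ∑< n (h ∘ level D c) ≡ sumBy h (levels D c)
∑<-level []                c       h = refl
∑<-level (_▸_ {n} D nothing) c     h = begin
  ∑< (suc n) (h ∘ level D c)              ≡⟨ ∑<-snoc n _ ⟩
  ∑< n (h ∘ level D c) + h (level D c n)  ≡⟨ cong₂ _+_ (∑<-level D c h) (cong (h ∘ fromMaybe 0) (labelOf-≥ D c ≤-refl)) ⟩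
  sumBy h (levels D c) + h 0              ≡⟨ +-comm _ (h 0) ⟩
  h 0 + sumBy h (levels D c)              ∎
  where open ≡-Reasoning
∑<-level (_▸_ {n} D (just j)) (c , l) h = begin
  ∑< (suc n) (h ∘ level (D ▸ just j) (c , l))
    ≡⟨ ∑<-snoc n _ ⟩
  ∑< n (h ∘ level (D ▸ just j) (c , l)) + h (level (D ▸ just j) (c , l) n)
    ≡⟨ cong₂ _+_ (∑<-cong n (cong (h ∘ fromMaybe 0) ∘ labelOf-▸-< D j c l)) (cong (h ∘ fromMaybe 0) (labelOf-▸-new D j c l)) ⟩
  ∑< n (h ∘ level D c) + h (toℕ l)
    ≡⟨ cong (_+ h (toℕ l)) (∑<-level D c h) ⟩
  sumBy h (levels D c) + h (toℕ l)
    ≡⟨ +-comm _ (h (toℕ l)) ⟩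
  h (toℕ l) + sumBy h (levels D c)
    ∎
  where open ≡-Reasoning

labelledExtensions : (k q r : ℕ) → Diagram n → ℕ
labelledExtensions k q r D =
  sumBy (λ c → 𝟙 (isLabeling D c) * extensions k (levels D c) q (roots D) r) (allLabelings k D)

labelledExtensions-▸nothing : ∀ q r (D : Diagram n) → labelledExtensions k q r (D ▸ nothing)
  ≡ sumBy (λ c → 𝟙 (isLabeling D c) * extensions k (0 ∷ levels D c) q (suc (roots D)) r) (allLabelings k D)
labelledExtensions-▸nothing {k = k} q r D =
  sumBy-cong (λ c → cong (λ b → 𝟙 b * extensions k (0 ∷ levels D c) q (suc (roots D)) r) (isLabeling-▸nothing D c))
             (allLabelings k D)

labelledExtensions-▸just : ∀ q r (D : Diagram n) j → labelledExtensions k q r (D ▸ just j)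
  ≡ sumBy (λ c → 𝟙 (isLabeling D c) * sumFrom (level D c (toℕ j)) k (λ l → extensions k (l ∷ levels D c) q (roots D) r))
          (allLabelings k D)
labelledExtensions-▸just {k = k} q r D j = begin
  sumBy F (concatMap (λ c → map (c ,_) (allFin k)) (allLabelings k D))
    ≡⟨ sumBy-concatMap F (λ c → map (c ,_) (allFin k)) (allLabelings k D) ⟩
  sumBy (λ c → sumBy F (map (c ,_) (allFin k))) (allLabelings k D)
    ≡⟨ sumBy-cong (λ c → trans (sumBy-map F (c ,_) (allFin k)) (extendLabeling c)) (allLabelings k D) ⟩
  sumBy (λ c → 𝟙 (isLabeling D c) * sumFrom (level D c (toℕ j)) k (Y c)) (allLabelings k D)
    ∎
  where
  open ≡-Reasoning
  F : Labeling k (D ▸ just j) → ℕ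
  F c′ = 𝟙 (isLabeling (D ▸ just j) c′) * extensions k (levels (D ▸ just j) c′) q (roots D) r
  Y : Labeling k D → ℕ → ℕ
  Y c l = extensions k (l ∷ levels D c) q (roots D) r
  extendLabeling : ∀ c → sumBy (λ l → F (c , l)) (allFin k) ≡ 𝟙 (isLabeling D c) * sumFrom (level D c (toℕ j)) k (Y c)
  extendLabeling c = begin
    sumBy (λ l → F (c , l)) (allFin k)
      ≡⟨ sumBy-cong (λ l → trans (cong (λ b → 𝟙 b * Y c (toℕ l)) (isLabeling-▸just D j c l)) (𝟙-∧ (isLabeling D c) _ (Y c (toℕ l)))) (allFin k) ⟩
    sumBy (λ l → 𝟙 (isLabeling D c) * (𝟙 (level D c (toℕ j) ≤ᵇ toℕ l) * Y c (toℕ l))) (allFin k)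
      ≡⟨ sumBy-*ˡ (𝟙 (isLabeling D c)) _ (allFin k) ⟩
    𝟙 (isLabeling D c) * sumBy (λ l → 𝟙 (level D c (toℕ j) ≤ᵇ toℕ l) * Y c (toℕ l)) (allFin k)
      ≡⟨ cong (𝟙 (isLabeling D c) *_) (sumBy-allFin k (λ l → 𝟙 (level D c (toℕ j) ≤ᵇ l) * Y c l)) ⟩
    𝟙 (isLabeling D c) * sumFrom (level D c (toℕ j)) k (Y c)
      ∎

labelledExtensions-▸ : ∀ q r (D : Diagram n) →
  sumBy (λ x → labelledExtensions k q r (D ▸ x)) (nothing ∷ map just (allFin n)) ≡ labelledExtensions k (suc q) r D
labelledExtensions-▸ {n} {k} q r D = begin
  labelledExtensions k q r (D ▸ nothing) + sumBy (λ x → labelledExtensions k q r (D ▸ x)) (map just (allFin n))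
    ≡⟨ cong₂ _+_ (labelledExtensions-▸nothing q r D) (sumBy-map _ just (allFin n)) ⟩
  R + sumBy (λ j → labelledExtensions k q r (D ▸ just j)) (allFin n)
    ≡⟨ cong (_+_ R) (sumBy-cong (labelledExtensions-▸just q r D) (allFin n)) ⟩
  R + sumBy (λ j → sumBy (λ c → 𝟙 (b c) * V c (toℕ j)) labs) (allFin n)
    ≡⟨ cong (_+_ R) (sumBy-comm (λ j c → 𝟙 (b c) * V c (toℕ j)) (allFin n) labs) ⟩
  R + sumBy (λ c → sumBy (λ j → 𝟙 (b c) * V c (toℕ j)) (allFin n)) labs
    ≡⟨ cong (_+_ R) (sumBy-cong attach labs) ⟩
  R + sumBy (λ c → 𝟙 (b c) * sumBy (λ x → sumFrom x k (Y c)) (levels D c)) labs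
    ≡⟨ sumBy-+ _ _ labs ⟨
  sumBy (λ c → 𝟙 (b c) * extensions k (0 ∷ levels D c) q (suc (roots D)) r + 𝟙 (b c) * sumBy (λ x → sumFrom x k (Y c)) (levels D c)) labs
    ≡⟨ sumBy-cong (λ c → *-distribˡ-+ (𝟙 (b c)) _ _) labs ⟨
  labelledExtensions k (suc q) r D
    ∎
  where
  open ≡-Reasoning
  labs = allLabelings k D
  b : Labeling k D → Bool
  b = isLabeling D
  Y : Labeling k D → ℕ → ℕ
  Y c l = extensions k (l ∷ levels D c) q (roots D) r
  V : Labeling k D → ℕ → ℕ
  V c m = sumFrom (level D c m) k (Y c)
  R = sumBy (λ c → 𝟙 (b c) * extensions k (0 ∷ levels D c) q (suc (roots D)) r) labs
  attach : ∀ c → sumBy (λ j → 𝟙 (b c) * V c (toℕ j)) (allFin n) ≡ 𝟙 (b c) * sumBy (λ x → sumFrom x k (Y c)) (levels D c)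
  attach c = begin
    sumBy (λ j → 𝟙 (b c) * V c (toℕ j)) (allFin n)   ≡⟨ sumBy-*ˡ (𝟙 (b c)) (V c ∘ toℕ) (allFin n) ⟩
    𝟙 (b c) * sumBy (V c ∘ toℕ) (allFin n)           ≡⟨ cong (𝟙 (b c) *_) (sumBy-allFin n (V c)) ⟩
    𝟙 (b c) * ∑< n (V c)                             ≡⟨ cong (𝟙 (b c) *_) (∑<-level D c (λ x → sumFrom x k (Y c))) ⟩
    𝟙 (b c) * sumBy (λ x → sumFrom x k (Y c)) (levels D c) ∎

sumBy-allDiagrams : ∀ k n q r → sumBy (labelledExtensions k q r) (allDiagrams n) ≡ extensions k [] (n + q) 0 r
sumBy-allDiagrams k zero    q r = trans (+-identityʳ _) (trans (+-identityʳ _) (+-identityʳ _))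
sumBy-allDiagrams k (suc n) q r = begin
  sumBy (labelledExtensions k q r) (allDiagrams (suc n))
    ≡⟨ sumBy-concatMap _ (λ D → map (D ▸_) (nothing ∷ map just (allFin n))) (allDiagrams n) ⟩
  sumBy (λ D → sumBy (labelledExtensions k q r) (map (D ▸_) (nothing ∷ map just (allFin n)))) (allDiagrams n)
    ≡⟨ sumBy-cong (λ D → trans (sumBy-map (labelledExtensions k q r) (D ▸_) (nothing ∷ map just (allFin n))) (labelledExtensions-▸ q r D)) (allDiagrams n) ⟩
  sumBy (labelledExtensions k (suc q) r) (allDiagrams n)
    ≡⟨ sumBy-allDiagrams k n (suc q) r ⟩
  extensions k [] (n + suc q) 0 r
    ≡⟨ cong (λ m → extensions k [] m 0 r) (+-suc n q) ⟩
  extensions k [] (suc n + q) 0 r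
    ∎
  where open ≡-Reasoning

edges≡ᵇn∸r≡roots≡ᵇr : ∀ (D : Diagram n) r → r ≤ n → (edges D ≡ᵇ n ∸ r) ≡ (roots D ≡ᵇ r)
edges≡ᵇn∸r≡roots≡ᵇr {n} D r r≤n with roots D ≟ r
... | yes refl = trans (cong (_≡ᵇ n ∸ roots D) edges≡) (trans (≡ᵇ-refl (n ∸ roots D)) (sym (≡ᵇ-refl (roots D))))
  where
  edges≡ : edges D ≡ n ∸ roots D
  edges≡ = trans (sym (m+n∸n≡m (edges D) (roots D))) (cong (_∸ roots D) (edges+roots D))
... | no roots≢r = trans (≢⇒≡ᵇ≡false edges≢) (sym (≢⇒≡ᵇ≡false roots≢r))
  where
  edges≢ : edges D ≢ n ∸ r
  edges≢ e≡ = roots≢r (+-cancelˡ-≡ (edges D) (roots D) r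
    (trans (edges+roots D) (trans (sym (m∸n+n≡m r≤n)) (cong (_+ r) (sym e≡)))))

sum-wt≡extensions : ∀ k n r → r ≤ n → sum (map (wt k) (𝒞 n r)) ≡ extensions k [] n 0 r
sum-wt≡extensions k n r r≤n = begin
  sum (map (wt k) (𝒞 n r))
    ≡⟨ sumBy-filterᵇ (wt k) (λ D → edges D ≡ᵇ n ∸ r) (allDiagrams n) ⟩
  sumBy (λ D → 𝟙 (edges D ≡ᵇ n ∸ r) * wt k D) (allDiagrams n)
    ≡⟨ sumBy-cong weighted (allDiagrams n) ⟩
  sumBy (labelledExtensions k 0 r) (allDiagrams n)
    ≡⟨ sumBy-allDiagrams k n 0 r ⟩
  extensions k [] (n + 0) 0 r
    ≡⟨ cong (λ m → extensions k [] m 0 r) (+-identityʳ n) ⟩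
  extensions k [] n 0 r
    ∎
  where
  open ≡-Reasoning
  weighted : ∀ D → 𝟙 (edges D ≡ᵇ n ∸ r) * wt k D ≡ labelledExtensions k 0 r D
  weighted D = begin
    𝟙 (edges D ≡ᵇ n ∸ r) * wt k D
      ≡⟨ cong₂ (λ b w → 𝟙 b * w) (edges≡ᵇn∸r≡roots≡ᵇr D r r≤n) (length-filterᵇ (isLabeling D) (allLabelings k D)) ⟩
    𝟙 (roots D ≡ᵇ r) * sumBy (𝟙 ∘ isLabeling D) (allLabelings k D)
      ≡⟨ sumBy-*ˡ (𝟙 (roots D ≡ᵇ r)) (𝟙 ∘ isLabeling D) (allLabelings k D) ⟨
    sumBy (λ c → 𝟙 (roots D ≡ᵇ r) * 𝟙 (isLabeling D c)) (allLabelings k D)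
      ≡⟨ sumBy-cong (λ c → *-comm (𝟙 (roots D ≡ᵇ r)) (𝟙 (isLabeling D c))) (allLabelings k D) ⟩
    labelledExtensions k 0 r D
      ∎

-- The recursion in k

sumℤ-*-pos : ∀ c (g : ℕ → ℕ) xs → sumℤ (map (λ i → c ℤ.* + g i) xs) ≡ c ℤ.* + sumBy g xs
sumℤ-*-pos c g []       = sym (ℤ.*-zeroʳ c)
sumℤ-*-pos c g (x ∷ xs) = begin
  c ℤ.* + g x ℤ.+ sumℤ (map (λ i → c ℤ.* + g i) xs)  ≡⟨ cong (ℤ._+_ (c ℤ.* + g x)) (sumℤ-*-pos c g xs) ⟩
  c ℤ.* + g x ℤ.+ c ℤ.* + sumBy g xs                  ≡⟨ ℤ.*-distribˡ-+ c (+ g x) (+ sumBy g xs) ⟨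
  c ℤ.* (+ g x ℤ.+ + sumBy g xs)                      ≡⟨ cong (c ℤ.*_) (ℤ.pos-+ (g x) (sumBy g xs)) ⟨
  c ℤ.* + sumBy g (x ∷ xs)                            ∎
  where open ≡-Reasoning

sumBy-range : ∀ r n (g : ℕ → ℕ) → (∀ {m} → m < r → g m ≡ 0) → sumBy g (range r n) ≡ ∑< (suc n) g
sumBy-range r n g below = trans (sumBy-map g (_+_ r) (upTo (suc n ∸ r))) (shifted r n g below)
  where
  shifted : ∀ r n (g : ℕ → ℕ) → (∀ {m} → m < r → g m ≡ 0) → ∑< (suc n ∸ r) (g ∘ (_+_ r)) ≡ ∑< (suc n) g
  shifted zero    n       g below = refl
  shifted (suc r) zero    g below rewrite 0∸n≡0 r = sym (trans (+-identityʳ (g 0)) (below (s≤s z≤n)))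
  shifted (suc r) (suc n) g below = begin
    ∑< (suc n ∸ r) (g ∘ suc ∘ (_+_ r))   ≡⟨ shifted r n (g ∘ suc) (below ∘ s≤s) ⟩
    ∑< (suc n) (g ∘ suc)                ≡⟨ cong (_+ ∑< (suc n) (g ∘ suc)) (below (s≤s z≤n)) ⟨
    g 0 + ∑< (suc n) (g ∘ suc)          ≡⟨ ∑<-suc (suc n) g ⟨
    ∑< (suc (suc n)) g                  ∎
    where open ≡-Reasoning

∑<-*-𝟙≡ : ∀ n (f : ℕ → ℕ) r → (∀ {m} → n ≤ m → f m ≡ 0) → ∑< n (λ m → f m * 𝟙 (m ≡ᵇ r)) ≡ f r
∑<-*-𝟙≡ zero    f r       above = sym (above z≤n)
∑<-*-𝟙≡ (suc n) f zero    above = begin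
  ∑< (suc n) (λ m → f m * 𝟙 (m ≡ᵇ 0))  ≡⟨ ∑<-suc n _ ⟩
  f 0 * 1 + ∑< n (λ _ → f _ * 0)        ≡⟨ cong₂ _+_ (*-identityʳ (f 0)) (∑<-zero n (λ {m} _ → *-zeroʳ (f (suc m)))) ⟩
  f 0 + 0                               ≡⟨ +-identityʳ (f 0) ⟩
  f 0                                   ∎
  where open ≡-Reasoning
∑<-*-𝟙≡ (suc n) f (suc r) above = begin
  ∑< (suc n) (λ m → f m * 𝟙 (m ≡ᵇ suc r))                 ≡⟨ ∑<-suc n _ ⟩
  f 0 * 0 + ∑< n (λ m → f (suc m) * 𝟙 (m ≡ᵇ r))           ≡⟨ cong (_+ ∑< n (λ m → f (suc m) * 𝟙 (m ≡ᵇ r))) (*-zeroʳ (f 0)) ⟩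
  ∑< n (λ m → f (suc m) * 𝟙 (m ≡ᵇ r))                     ≡⟨ ∑<-*-𝟙≡ n (f ∘ suc) r (above ∘ s≤s) ⟩
  f (suc r)                                               ∎
  where open ≡-Reasoning

extensions-one : ∀ n r → extensions 1 [] n 0 r ≡ risingCoeff 0 n r
extensions-one n r = begin
  extensions 1 [] n 0 r                                        ≡⟨ extensions-suc 0 n r ⟩
  ∑< (suc n) (λ m → risingCoeff 0 n m * extensions 0 [] m 0 r) ≡⟨ ∑<-cong (suc n) (λ {m} _ → cong (risingCoeff 0 n m *_) (noLabels m)) ⟩
  ∑< (suc n) (λ m → risingCoeff 0 n m * 𝟙 (m ≡ᵇ r))            ≡⟨ ∑<-*-𝟙≡ (suc n) (risingCoeff 0 n) r (risingCoeff-vanish 0 n _) ⟩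
  risingCoeff 0 n r                                            ∎
  where
  open ≡-Reasoning
  noLabels : ∀ m → extensions 0 [] m 0 r ≡ 𝟙 (m ≡ᵇ r)
  noLabels m = trans (extensions-noLabels [] m 0 r) (cong (λ i → 𝟙 (i ≡ᵇ r)) (+-identityʳ m))

t≡sign*extensions : ∀ k n r → t n (suc k) r ≡ sign (n + r) ℤ.* + extensions (suc k) [] n 0 r
t≡sign*extensions zero    n r = trans (s≡sign*risingCoeff n r) (cong (λ z → sign (n + r) ℤ.* + z) (sym (extensions-one n r)))
t≡sign*extensions (suc k) n r = begin
  sumℤ (map (λ i → s n i ℤ.* t i (suc k) r) (range r n))  ≡⟨ cong sumℤ (map-cong term (range r n)) ⟩
  sumℤ (map (λ i → sign (n + r) ℤ.* + summand i) (range r n))   ≡⟨ sumℤ-*-pos (sign (n + r)) summand (range r n) ⟩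
  sign (n + r) ℤ.* + sumBy summand (range r n)                 ≡⟨ cong (λ z → sign (n + r) ℤ.* + z) (sumBy-range r n summand below) ⟩
  sign (n + r) ℤ.* + ∑< (suc n) summand                        ≡⟨ cong (λ z → sign (n + r) ℤ.* + z) (extensions-suc (suc k) n r) ⟨
  sign (n + r) ℤ.* + extensions (suc (suc k)) [] n 0 r   ∎
  where
  open ≡-Reasoning
  summand : ℕ → ℕ
  summand i = risingCoeff 0 n i * extensions (suc k) [] i 0 r
  below : ∀ {m} → m < r → summand m ≡ 0
  below {m} m<r = trans (cong (risingCoeff 0 n m *_) (extensions-vanish (suc k) [] m 0 r (subst (_< r) (sym (+-identityʳ m)) m<r)))
                        (*-zeroʳ (risingCoeff 0 n m))
  term : ∀ i → s n i ℤ.* t i (suc k) r ≡ sign (n + r) ℤ.* + summand i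
  term i = begin
    s n i ℤ.* t i (suc k) r
      ≡⟨ cong₂ ℤ._*_ (s≡sign*risingCoeff n i) (t≡sign*extensions k i r) ⟩
    sign (n + i) ℤ.* + a ℤ.* (sign (i + r) ℤ.* + b)
      ≡⟨ cong₂ (λ u v → u ℤ.* + a ℤ.* (v ℤ.* + b)) (sign-+ n i) (sign-+ i r) ⟩
    sign n ℤ.* sign i ℤ.* + a ℤ.* (sign i ℤ.* sign r ℤ.* + b)
      ≡⟨ regroup (sign n) (sign i) (sign r) (+ a) (+ b) ⟩
    sign i ℤ.* sign i ℤ.* (sign n ℤ.* sign r ℤ.* (+ a ℤ.* + b))
      ≡⟨ cong (ℤ._* (sign n ℤ.* sign r ℤ.* (+ a ℤ.* + b))) (sign-*-self i) ⟩
    + 1 ℤ.* (sign n ℤ.* sign r ℤ.* (+ a ℤ.* + b))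
      ≡⟨ ℤ.*-identityˡ _ ⟩
    sign n ℤ.* sign r ℤ.* (+ a ℤ.* + b)
      ≡⟨ cong₂ ℤ._*_ (sign-+ n r) (ℤ.pos-* a b) ⟨
    sign (n + r) ℤ.* + summand i
      ∎
    where
    a = risingCoeff 0 n i
    b = extensions (suc k) [] i 0 r
    regroup : ∀ σ τ υ α β → σ ℤ.* τ ℤ.* α ℤ.* (τ ℤ.* υ ℤ.* β) ≡ τ ℤ.* τ ℤ.* (σ ℤ.* υ ℤ.* (α ℤ.* β))
    regroup = ℤ-Solver.solve-∀

mainTheorem6 : (n k r : ℕ) → 1 ≤ k → 1 ≤ r → r ≤ n →
    t n k r ≡ ((- (+ 1)) ^ (n + r)) ℤ.* (+ (sum (map (wt k) (𝒞 n r))))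
mainTheorem6 n (suc k) r _ _ r≤n =
  trans (t≡sign*extensions k n r) (cong (λ z → sign (n + r) ℤ.* + z) (sym (sum-wt≡extensions (suc k) n r r≤n)))
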